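{- Let $q=3^r\ge 9$. Then $\mathcal{S}_q=\{2,(q+1)/2,q/3-1,2q/3-1\}$.
   Context: $\mathcal{T}_q$ is the set of functions $g:(\mathbb{Z}/q\mathbb{Z})^\times\to\{0,1\}$ such that $g(a)+g(-a)=1$ for all $a$, and $g(a)=0$ for every $a$ whose representative in $\{1,\dots,q-1\}$ is less than $q/3$. For $s\in(\mathbb{Z}/q\mathbb{Z})^\times$, $\theta_s$ denotes multiplication by $s$. $\mathcal{S}_q=\{s\in(\mathbb{Z}/q\mathbb{Z})^\times: s\ne 1\text{ and there exists } g\in\mathcal{T}_q \text{ with } g\circ\theta_s\in\mathcal{T}_q\}$. -}

module Defs where

open import Data.Nat using (ℕ; zero; suc; _+_; _*_; _∸_; _≤_; _<_; NonZero)
open import Data.Nat.DivMod using (_%_)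
open import Data.Nat.Coprimality using (Coprime)
open import Data.Fin using (Fin; toℕ)
open import Data.Product using (_×_; ∃)
open import Relation.Binary.PropositionalEquality using (_≡_; _≢_)

IsUnit : ℕ → ℕ → Set
IsUnit q a = 1 ≤ a × a < q × Coprime a q

-- A function g : (ℤ/qℤ)ˣ → {0,1}, given on representatives (values off units are irrelevant).
Fn : ℕ → Set
Fn q = ℕ → Fin 2

-- g ∈ 𝒯_q : g(a) + g(-a) = 1 for every unit a, and g(a) = 0 whenever the
-- representative a ∈ {1,…,q-1} satisfies a < q/3 (i.e. 3a < q).
InT : (q : ℕ) → Fn q → Set
InT q g =
  (∀ a → IsUnit q a → toℕ (g a) + toℕ (g (q ∸ a)) ≡ 1) ×
  (∀ a → IsUnit q a → 3 * a < q → toℕ (g a) ≡ 0)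

compθ : (q : ℕ) .{{_ : NonZero q}} → Fn q → ℕ → Fn q
compθ q g s a = g ((s * a) % q)

InS : (q : ℕ) .{{_ : NonZero q}} → ℕ → Set
InS q s = IsUnit q s × s ≢ 1 × ∃ λ (g : Fn q) → InT q g × InT q (compθ q g s)

{-# OPTIONS --safe #-}
module Submission where

-- Write q = 3m. As q is a power of 3, the units are the residues prime to 3, and for g ∈ 𝒯 the
-- rule g(a) + g(-a) = 1 forces g = 1 on the units of the upper third (a > 2m): g is free only on
-- the middle third. So if g and g ∘ θ_s both lie in 𝒯, then θ_s maps no unit of the lower third
-- into the upper third. For q ≥ 243 a case analysis on the size of s produces such a unit for every
-- s other than 2, (q+1)/2, m - 1 and 2m - 1 (for q ≤ 81 this is checked by computation).
-- Conversely, for each of these four multipliers g can be fixed on the middle third by parity, by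
-- position relative to q/2, or by the residue mod 3, so that g ∘ θ_s lies in 𝒯 as well.

open import Defs
open import Data.Nat
open import Data.Nat.Properties
open import Data.Nat.Divisibility
open import Data.Nat.DivMod
open import Data.Nat.Coprimality using (Coprime; coprime-divisor)
open import Data.Nat.Primality using (Prime; prime?; euclidsLemma; prime⇒irreducible)
open import Data.Nat.Tactic.RingSolver using (solve-∀)
open import Data.Bool using (Bool; true; false; not; if_then_else_)
open import Data.Fin using (Fin; toℕ; fromℕ<)
open import Data.Fin.Patterns using (0F; 1F)
open import Data.Fin.Properties using (any?; all?; toℕ<n; toℕ-fromℕ<)
open import Data.Product using (_×_; _,_; proj₁; proj₂; ∃; ∃₂)
open import Data.Sum using (_⊎_; inj₁; inj₂; [_,_]′)
open import Function.Base using (id; _∘_)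
open import Function.Bundles using (_⇔_; mk⇔; Equivalence)
open import Relation.Nullary using (¬_; Dec; yes; no; does; contradiction; ¬?)
open import Relation.Nullary.Decidable using (from-yes; from-no; dec-true; dec-false; _×-dec_; _⊎-dec_)
open import Relation.Binary.Definitions using (tri<; tri≈; tri>)
open import Relation.Binary.PropositionalEquality

prime-3 : Prime 3
prime-3 = from-yes (prime? 3)

3∤* : ∀ {a b} → 3 ∤ a → 3 ∤ b → 3 ∤ a * b
3∤* {a} {b} 3∤a 3∤b 3∣ab = [ 3∤a , 3∤b ]′ (euclidsLemma a b prime-3 3∣ab)

3∤% : ∀ {a n} .{{_ : NonZero n}} → 3 ∣ n → 3 ∤ a → 3 ∤ a % n
3∤% 3∣n 3∤a 3∣a%n = 3∤a (∣n∣m%n⇒∣m 3∣n 3∣a%n)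

3∤∸ : ∀ {a n} → 3 ∣ n → a ≤ n → 3 ∤ a → 3 ∤ n ∸ a
3∤∸ {a} {n} 3∣n a≤n 3∤a 3∣n∸a =
  3∤a (∣m+n∣m⇒∣n (subst (3 ∣_) (sym (m∸n+n≡m a≤n)) 3∣n) 3∣n∸a)

3∣3* : ∀ m → 3 ∣ 3 * m
3∣3* m = ∣m⇒∣m*n m ∣-refl

3∤⇒coprime-3 : ∀ {a} → 3 ∤ a → Coprime a 3
3∤⇒coprime-3 3∤a (i∣a , i∣3) with prime⇒irreducible prime-3 i∣3
... | inj₁ i≡1 = i≡1
... | inj₂ refl = contradiction i∣a 3∤a

3∤⇒coprime-3^ : ∀ r {a} → 3 ∤ a → Coprime a (3 ^ r)
3∤⇒coprime-3^ zero    3∤a (_ , i∣1) = ∣1⇒≡1 i∣1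
3∤⇒coprime-3^ (suc r) 3∤a (i∣a , i∣3^1+r) =
  3∤⇒coprime-3^ r 3∤a (i∣a , coprime-divisor i⊥3 i∣3^1+r)
  where i⊥3 = 3∤⇒coprime-3 (λ 3∣i → 3∤a (∣-trans 3∣i i∣a))

coprime-3^1+r⇔3∤ : ∀ r {a} → Coprime a (3 ^ suc r) ⇔ 3 ∤ a
coprime-3^1+r⇔3∤ r = mk⇔ (λ a⊥q 3∣a → contradiction (a⊥q (3∣a , 3∣3* (3 ^ r))) λ ())
                         (3∤⇒coprime-3^ (suc r))

-- Units of ℤ/3mℤ when m is a power of 3.
IsUnit₃ : ℕ → ℕ → Set
IsUnit₃ m a = 1 ≤ a × a < 3 * m × 3 ∤ a

isUnit⇔isUnit₃ : ∀ r {a} → IsUnit (3 ^ suc r) a ⇔ IsUnit₃ (3 ^ r) a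
isUnit⇔isUnit₃ r = mk⇔ (λ (1≤a , a<q , a⊥q) → 1≤a , a<q , Equivalence.to (coprime-3^1+r⇔3∤ r) a⊥q)
                       (λ (1≤a , a<q , 3∤a) → 1≤a , a<q , Equivalence.from (coprime-3^1+r⇔3∤ r) 3∤a)

isUnit₃-∸ : ∀ {m a} → IsUnit₃ m a → IsUnit₃ m (3 * m ∸ a)
isUnit₃-∸ {m} (1≤a , a<q , 3∤a) =
  m<n⇒0<n∸m a<q , ∸-monoʳ-< 1≤a (<⇒≤ a<q) , 3∤∸ (3∣3* m) (<⇒≤ a<q) 3∤a

isUnit₃-*% : ∀ {m s a} .{{_ : NonZero (3 * m)}} → 3 ∤ s → 3 ∤ a → IsUnit₃ m (s * a % (3 * m))
isUnit₃-*% {m} {s} {a} 3∤s 3∤a =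
  n≢0⇒n>0 (λ x≡0 → 3∤x (subst (3 ∣_) (sym x≡0) (3 ∣0))) , m%n<n (s * a) (3 * m) , 3∤x
  where 3∤x = 3∤% (3∣3* m) (3∤* 3∤s 3∤a)

≤-by : ∀ {x y} k → y ≡ x + k → x ≤ y
≤-by {x} k refl = m≤m+n x k

<-by : ∀ {x y} k → y ≡ x + suc k → x < y
<-by {x} k refl = m<m+n x z<s

residue-∸ : ∀ {y a k z} → y + a ≡ k + z → a ≤ z → y ≡ k + (z ∸ a)
residue-∸ {y} {a} {k} {z} eq a≤z = begin
  y             ≡⟨ m+n∸n≡m y a ⟨
  y + a ∸ a     ≡⟨ cong (_∸ a) eq ⟩
  k + z ∸ a     ≡⟨ +-∸-assoc k a≤z ⟩
  k + (z ∸ a)   ∎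
  where open ≡-Reasoning

3∤-+3* : ∀ {u} j → 3 ∤ u → 3 ∤ u + j * 3
3∤-+3* {u} j 3∤u 3∣u+3j = 3∤u (∣m+n∣m⇒∣n (subst (3 ∣_) (+-comm u (j * 3)) 3∣u+3j) (n∣m*n j))

residue₃-cases : ∀ {a} → 3 ∤ a → ∃ λ j → a ≡ 1 + j * 3 ⊎ a ≡ 2 + j * 3
residue₃-cases {a} 3∤a with a % 3 | m%n<n a 3 | m≡m%n+[m/n]*n a 3
... | 0 | _ | a≡ = contradiction (divides (a / 3) a≡) 3∤a
... | 1 | _ | a≡ = a / 3 , inj₁ a≡
... | 2 | _ | a≡ = a / 3 , inj₂ a≡
... | suc (suc (suc _)) | s≤s (s≤s (s≤s ())) | _

parity-cases : ∀ a → ∃ λ b → a ≡ b * 2 ⊎ a ≡ 1 + b * 2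
parity-cases a with a % 2 | m%n<n a 2 | m≡m%n+[m/n]*n a 2
... | 0 | _ | a≡ = a / 2 , inj₁ a≡
... | 1 | _ | a≡ = a / 2 , inj₂ a≡
... | suc (suc _) | s≤s (s≤s ()) | _

%-sum-∸ : ∀ {x n} d .{{_ : NonZero d}} → x ≤ n → ((n ∸ x) % d + x % d) % d ≡ n % d
%-sum-∸ {x} {n} d x≤n = trans (sym (%-distribˡ-+ (n ∸ x) x d)) (cong (_% d) (m∸n+n≡m x≤n))

[n∸x]%2 : ∀ {x n} → n % 2 ≡ 1 → x ≤ n → (n ∸ x) % 2 ≡ 1 ∸ x % 2
[n∸x]%2 {x} {n} n%2≡1 x≤n = table (m%n<n (n ∸ x) 2) (m%n<n x 2) (trans (%-sum-∸ 2 x≤n) n%2≡1)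
  where
  table : ∀ {u v} → u < 2 → v < 2 → (u + v) % 2 ≡ 1 → u ≡ 1 ∸ v
  table {0} {0} _ _ ()
  table {0} {1} _ _ _ = refl
  table {1} {0} _ _ _ = refl
  table {1} {1} _ _ ()
  table {suc (suc _)} (s≤s (s≤s ())) _ _
  table {_} {suc (suc _)} _ (s≤s (s≤s ())) _

[n∸x]%3 : ∀ {x n} → 3 ∣ n → x ≤ n → 3 ∤ x → (n ∸ x) % 3 ≡ 3 ∸ x % 3
[n∸x]%3 {x} {n} 3∣n x≤n 3∤x =
  table (m%n<n (n ∸ x) 3) (m%n<n x 3) (3∤x ∘ m%n≡0⇒n∣m x 3)
        (trans (%-sum-∸ 3 x≤n) (n∣m⇒m%n≡0 n 3 3∣n))
  where
  table : ∀ {u v} → u < 3 → v < 3 → v ≢ 0 → (u + v) % 3 ≡ 0 → u ≡ 3 ∸ v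
  table {_} {0} _ _ v≢0 _ = contradiction refl v≢0
  table {0} {1} _ _ _ ()
  table {1} {1} _ _ _ ()
  table {2} {1} _ _ _ _ = refl
  table {0} {2} _ _ _ ()
  table {1} {2} _ _ _ _ = refl
  table {2} {2} _ _ _ ()
  table {suc (suc (suc _))} (s≤s (s≤s (s≤s ()))) _ _ _
  table {_} {suc (suc (suc _))} _ (s≤s (s≤s (s≤s ()))) _ _

residue-% : ∀ {y k x n} .{{_ : NonZero n}} → y ≡ k * n + x → x < n → y % n ≡ x
residue-% {k = k} {x} {n} refl x<n =
  trans (cong (_% n) (+-comm (k * n) x)) (trans ([m+kn]%n≡m%n x k n) (m<n⇒m%n≡m x<n))

n∣x∧0<x<n+n⇒x≡n : ∀ {n x} → n ∣ x → 0 < x → x < n + n → x ≡ n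
n∣x∧0<x<n+n⇒x≡n {n} (divides zero refl) ()
n∣x∧0<x<n+n⇒x≡n {n} (divides 1 refl) _ _ = +-identityʳ n
n∣x∧0<x<n+n⇒x≡n {n} (divides (suc (suc k)) refl) _ x<2n =
  contradiction (+-monoʳ-≤ n (m≤m+n n (k * n))) (<⇒≱ x<2n)

*-∸-% : ∀ s {a n} .{{_ : NonZero n}} → a ≤ n → 0 < s * a % n → s * (n ∸ a) % n ≡ n ∸ s * a % n
*-∸-% s {a} {n} a≤n 0<X = begin
  Y          ≡⟨ m+n∸n≡m Y X ⟨
  Y + X ∸ X  ≡⟨ cong (_∸ X) Y+X≡n ⟩
  n ∸ X      ∎
  where
  open ≡-Reasoning
  X = s * a % n
  Y = s * (n ∸ a) % n
  [Y+X]%n≡0 : (Y + X) % n ≡ 0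
  [Y+X]%n≡0 = begin
    (Y + X) % n                  ≡⟨ %-distribˡ-+ (s * (n ∸ a)) (s * a) n ⟨
    (s * (n ∸ a) + s * a) % n    ≡⟨ cong (_% n) (*-distribˡ-+ s (n ∸ a) a) ⟨
    s * (n ∸ a + a) % n          ≡⟨ cong (λ t → s * t % n) (m∸n+n≡m a≤n) ⟩
    s * n % n                    ≡⟨ m*n%n≡0 s n ⟩
    0                            ∎
  Y+X≡n : Y + X ≡ n
  Y+X≡n = n∣x∧0<x<n+n⇒x≡n (m%n≡0⇒n∣m (Y + X) n [Y+X]%n≡0) (<-≤-trans 0<X (m≤n+m X Y))
                           (+-mono-< (m%n<n _ n) (m%n<n _ n))

odd≢x+x : ∀ {n} x → n % 2 ≡ 1 → n ≢ x + x
odd≢x+x x n%2≡1 refl = contradiction (trans (sym n%2≡1) [x+x]%2≡0) λ ()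
  where
  [x+x]%2≡0 : (x + x) % 2 ≡ 0
  [x+x]%2≡0 = trans (cong (λ y → (x + y) % 2) (sym (+-identityʳ x)))
                    (trans (cong (_% 2) (*-comm 2 x)) (m*n%n≡0 x 2))

-- 𝒯 and 𝒮 on the thirds of {1, …, 3m-1}: lower x < m, middle m ≤ x ≤ 2m, upper 2m < x

3m∸x<m : ∀ {m x} → 2 * m < x → x ≤ 3 * m → 3 * m ∸ x < m
3m∸x<m {m} {x} 2m<x x≤3m = subst (3 * m ∸ x <_) (m+n∸n≡m m (2 * m)) (∸-monoʳ-< 2m<x x≤3m)

2m<3m∸x : ∀ {m x} → x < m → 2 * m < 3 * m ∸ x
2m<3m∸x {m} {x} x<m = subst (_< 3 * m ∸ x) (m+n∸m≡n m (2 * m)) (∸-monoʳ-< x<m (m≤m+n m (2 * m)))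

middle-∸ : ∀ {m x} → m ≤ x → x ≤ 2 * m → m ≤ 3 * m ∸ x × 3 * m ∸ x ≤ 2 * m
middle-∸ {m} {x} m≤x x≤2m =
  subst (_≤ 3 * m ∸ x) (m+n∸n≡m m (2 * m)) (∸-monoʳ-≤ (3 * m) x≤2m) ,
  subst (3 * m ∸ x ≤_) (m+n∸m≡n m (2 * m)) (∸-monoʳ-≤ (3 * m) m≤x)

thirds : ∀ m x → x < m ⊎ (m ≤ x × x ≤ 2 * m) ⊎ 2 * m < x
thirds m x with x <? m | 2 * m <? x
... | yes x<m | _        = inj₁ x<m
... | no _    | yes 2m<x = inj₂ (inj₂ 2m<x)
... | no x≮m  | no 2m≮x  = inj₂ (inj₁ (≮⇒≥ x≮m , ≮⇒≥ 2m≮x))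

InT₃ : ℕ → (ℕ → Fin 2) → Set
InT₃ m g = (∀ a → IsUnit₃ m a → toℕ (g a) + toℕ (g (3 * m ∸ a)) ≡ 1) ×
           (∀ a → IsUnit₃ m a → a < m → toℕ (g a) ≡ 0)

inT⇔inT₃ : ∀ r g → InT (3 ^ suc r) g ⇔ InT₃ (3 ^ r) g
inT⇔inT₃ r g = mk⇔
  (λ (sum≡1 , lower≡0) → (λ a u → sum≡1 a (from u)) ,
                          (λ a u a<m → lower≡0 a (from u) (*-monoʳ-< 3 a<m)))
  (λ (sum≡1 , lower≡0) → (λ a u → sum≡1 a (to u)) ,
                          (λ a u 3a<q → lower≡0 a (to u) (*-cancelˡ-< 3 a (3 ^ r) 3a<q)))
  where
  to : ∀ {a} → IsUnit (3 ^ suc r) a → IsUnit₃ (3 ^ r) a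
  to = Equivalence.to (isUnit⇔isUnit₃ r)
  from : ∀ {a} → IsUnit₃ (3 ^ r) a → IsUnit (3 ^ suc r) a
  from = Equivalence.from (isUnit⇔isUnit₃ r)

InS₃ : (m : ℕ) .{{_ : NonZero (3 * m)}} → ℕ → Set
InS₃ m s = IsUnit₃ m s × s ≢ 1 × ∃ λ (g : ℕ → Fin 2) → InT₃ m g × InT₃ m (compθ (3 * m) g s)

inS⇔inS₃ : ∀ r s .{{_ : NonZero (3 ^ suc r)}} → InS (3 ^ suc r) s ⇔ InS₃ (3 ^ r) s
inS⇔inS₃ r s = mk⇔
  (λ (u , s≢1 , g , g∈T , g∘θ∈T) → U.to u , s≢1 , g , T.to g g∈T , T.to _ g∘θ∈T)
  (λ (u , s≢1 , g , g∈T , g∘θ∈T) → U.from u , s≢1 , g , T.from g g∈T , T.from _ g∘θ∈T)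
  where
  module U = Equivalence (isUnit⇔isUnit₃ r {s})
  module T g = Equivalence (inT⇔inT₃ r g)

-- y mod 3m lies in the upper third; stated without _%_ so that no NonZero instance is needed.
UpperResidue : ℕ → ℕ → Set
UpperResidue m y = ∃₂ λ k x → y ≡ k * (3 * m) + x × 2 * m < x × x < 3 * m

SendsLowToHighVia : ℕ → ℕ → ℕ → Set
SendsLowToHighVia m s a = 1 ≤ a × 3 ∤ a × a < m × UpperResidue m (s * a)

SendsLowToHigh : ℕ → ℕ → Set
SendsLowToHigh m s = ∃ (SendsLowToHighVia m s)

inT₃-upper≡1 : ∀ {m g x} → InT₃ m g → IsUnit₃ m x → 2 * m < x → toℕ (g x) ≡ 1
inT₃-upper≡1 {m} {g} {x} (sum≡1 , lower≡0) ux 2m<x = begin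
  toℕ (g x)                           ≡⟨ cong (λ y → toℕ (g y)) (m∸[m∸n]≡n x≤3m) ⟨
  toℕ (g (3 * m ∸ y))                 ≡⟨ cong (_+ toℕ (g (3 * m ∸ y))) (lower≡0 y (isUnit₃-∸ {m} ux) y<m) ⟨
  toℕ (g y) + toℕ (g (3 * m ∸ y))     ≡⟨ sum≡1 y (isUnit₃-∸ {m} ux) ⟩
  1                                   ∎
  where
  open ≡-Reasoning
  y = 3 * m ∸ x
  x≤3m = <⇒≤ (proj₁ (proj₂ ux))
  y<m : y < m
  y<m = 3m∸x<m 2m<x x≤3m

inS₃⇒¬sendsLowToHigh : ∀ {m s} .{{_ : NonZero (3 * m)}} → InS₃ m s → ¬ SendsLowToHigh m s
inS₃⇒¬sendsLowToHigh {m} {s} ((_ , _ , 3∤s) , _ , g , g∈T , g∘θ∈T)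
                     (a , 1≤a , 3∤a , a<m , k , x , sa≡ , 2m<x , x<3m) =
  contradiction (trans (sym gx≡0) gx≡1) λ ()
  where
  sa%≡x = residue-% {k = k} sa≡ x<3m
  gx≡0 : toℕ (g x) ≡ 0
  gx≡0 = subst (λ y → toℕ (g y) ≡ 0) sa%≡x
           (proj₂ g∘θ∈T a (1≤a , <-≤-trans a<m (m≤n*m m 3) , 3∤a) a<m)
  gx≡1 : toℕ (g x) ≡ 1
  gx≡1 = inT₃-upper≡1 g∈T (subst (IsUnit₃ m) sa%≡x (isUnit₃-*% {m} 3∤s 3∤a)) 2m<x

bit : Bool → Fin 2
bit b = if b then 0F else 1F

bit-not : ∀ b → toℕ (bit b) + toℕ (bit (not b)) ≡ 1
bit-not true  = refl
bit-not false = refl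

-- The candidate element of 𝒯 whose zero set on the middle third is given by P.
gOf : ℕ → (ℕ → Bool) → ℕ → Fin 2
gOf m P x with x <? m | 2 * m <? x
... | yes _ | _     = 0F
... | no _  | yes _ = 1F
... | no _  | no _  = bit (P x)

Complementary : ℕ → (ℕ → Bool) → Set
Complementary m P = ∀ x → IsUnit₃ m x → m ≤ x → x ≤ 2 * m → P (3 * m ∸ x) ≡ not (P x)

Admissible : ℕ → (ℕ → Bool) → ℕ → Set
Admissible m P x = x < m ⊎ (x ≤ 2 * m × P x ≡ true)

module _ {m : ℕ} {P : ℕ → Bool} where

  gOf-lower : ∀ {x} → x < m → toℕ (gOf m P x) ≡ 0
  gOf-lower {x} x<m with x <? m | 2 * m <? x
  ... | yes _   | _ = refl
  ... | no x≮m  | _ = contradiction x<m x≮m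

  gOf-upper : ∀ {x} → 2 * m < x → toℕ (gOf m P x) ≡ 1
  gOf-upper {x} 2m<x with x <? m | 2 * m <? x
  ... | yes x<m | _        = contradiction (<-trans x<m (≤-<-trans (m≤m+n m (m + 0)) 2m<x)) (<-irrefl refl)
  ... | no _    | yes _    = refl
  ... | no _    | no 2m≮x  = contradiction 2m<x 2m≮x

  gOf-middle : ∀ {x} → m ≤ x → x ≤ 2 * m → gOf m P x ≡ bit (P x)
  gOf-middle {x} m≤x x≤2m with x <? m | 2 * m <? x
  ... | yes x<m | _       = contradiction m≤x (<⇒≱ x<m)
  ... | no _    | yes 2m<x = contradiction x≤2m (<⇒≱ 2m<x)
  ... | no _    | no _    = refl

  gOf-sum : Complementary m P → ∀ {a} → IsUnit₃ m a → toℕ (gOf m P a) + toℕ (gOf m P (3 * m ∸ a)) ≡ 1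
  gOf-sum compl {a} ua@(_ , a<3m , _) with thirds m a
  ... | inj₁ a<m         = cong₂ _+_ (gOf-lower a<m) (gOf-upper (2m<3m∸x a<m))
  ... | inj₂ (inj₂ 2m<a) = cong₂ _+_ (gOf-upper 2m<a) (gOf-lower (3m∸x<m 2m<a (<⇒≤ a<3m)))
  ... | inj₂ (inj₁ (m≤a , a≤2m)) = begin
    toℕ (gOf m P a) + toℕ (gOf m P (3 * m ∸ a))     ≡⟨ cong₂ (λ u v → toℕ u + toℕ v) (gOf-middle m≤a a≤2m)
                                                                (gOf-middle (proj₁ a′) (proj₂ a′)) ⟩
    toℕ (bit (P a)) + toℕ (bit (P (3 * m ∸ a)))     ≡⟨ cong (λ b → toℕ (bit (P a)) + toℕ (bit b))
                                                           (compl a ua m≤a a≤2m) ⟩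
    toℕ (bit (P a)) + toℕ (bit (not (P a)))         ≡⟨ bit-not (P a) ⟩
    1                                               ∎
    where
    open ≡-Reasoning
    a′ = middle-∸ m≤a a≤2m

  gOf-inT₃ : Complementary m P → InT₃ m (gOf m P)
  gOf-inT₃ compl = (λ a ua → gOf-sum compl ua) , (λ a _ a<m → gOf-lower a<m)

  gOf-admissible : ∀ {x} → Admissible m P x → toℕ (gOf m P x) ≡ 0
  gOf-admissible (inj₁ x<m) = gOf-lower x<m
  gOf-admissible {x} (inj₂ (x≤2m , Px)) with thirds m x
  ... | inj₁ x<m               = gOf-lower x<m
  ... | inj₂ (inj₁ (m≤x , _))  = cong toℕ (trans (gOf-middle m≤x x≤2m) (cong bit Px))
  ... | inj₂ (inj₂ 2m<x)       = contradiction x≤2m (<⇒≱ 2m<x)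

AdmissibleImages : (m : ℕ) .{{_ : NonZero (3 * m)}} → (ℕ → Bool) → ℕ → Set
AdmissibleImages m P s = ∀ a → IsUnit₃ m a → a < m → Admissible m P (s * a % (3 * m))

gOf∘θ-inT₃ : ∀ {m P s} .{{_ : NonZero (3 * m)}} → Complementary m P → 3 ∤ s → AdmissibleImages m P s →
             InT₃ m (compθ (3 * m) (gOf m P) s)
gOf∘θ-inT₃ {m} {P} {s} compl 3∤s adm = sum≡1 , λ a ua a<m → gOf-admissible (adm a ua a<m)
  where
  sum≡1 : ∀ a → IsUnit₃ m a → toℕ (gOf m P (s * a % (3 * m))) + toℕ (gOf m P (s * (3 * m ∸ a) % (3 * m))) ≡ 1
  sum≡1 a (_ , a<3m , 3∤a) =
    subst (λ y → toℕ (gOf m P (s * a % (3 * m))) + toℕ (gOf m P y) ≡ 1)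
          (sym (*-∸-% s (<⇒≤ a<3m) (proj₁ ux))) (gOf-sum compl ux)
    where ux = isUnit₃-*% {m} 3∤s 3∤a

inS₃-via : ∀ {m s} P .{{_ : NonZero (3 * m)}} → IsUnit₃ m s → s ≢ 1 →
           Complementary m P → AdmissibleImages m P s → InS₃ m s
inS₃-via {m} P us s≢1 compl adm =
  us , s≢1 , gOf m P , gOf-inT₃ compl , gOf∘θ-inT₃ compl (proj₂ (proj₂ us)) adm

-- With m = 2c + 1 = q/3 these are 2, (q+1)/2, q/3 - 1 and 2q/3 - 1.
Candidate : ℕ → ℕ → Set
Candidate c s = s ≡ 2 ⊎ s ≡ 3 * c + 2 ⊎ s ≡ 2 * c ⊎ s ≡ 4 * c + 1

isEven : ℕ → Bool
isEven x = does (x % 2 ≟ 0)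

aboveHalf : ℕ → ℕ → Bool
aboveHalf n x = does (n <? x + x)

residueIs : ℕ → ℕ → Bool
residueIs k x = does (x % 3 ≟ k)

does-complement : ∀ {A B : Set} (a? : Dec A) (b? : Dec B) → (A → ¬ B) → (¬ A → B) → does b? ≡ not (does a?)
does-complement (yes a) b? A⇒¬B _   = dec-false b? (A⇒¬B a)
does-complement (no ¬a) b? _   ¬A⇒B = dec-true b? (¬A⇒B ¬a)

3[1+2c]%2≡1 : ∀ c → 3 * suc (2 * c) % 2 ≡ 1
3[1+2c]%2≡1 c = residue-% {k = 3 * c + 1} (3[1+2c]≡ c) (s≤s (s≤s z≤n))
  where
  3[1+2c]≡ : ∀ c → 3 * suc (2 * c) ≡ (3 * c + 1) * 2 + 1
  3[1+2c]≡ = solve-∀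

complementary-residueIs : ∀ {m} k → 0 < k → k < 3 → Complementary m (residueIs k)
complementary-residueIs {m} k 0<k k<3 x (_ , x<3m , 3∤x) _ _ =
  trans (cong (λ u → does (u ≟ k)) ([n∸x]%3 (3∣3* m) (<⇒≤ x<3m) 3∤x))
        (flip 0<k k<3 (3∤x ∘ m%n≡0⇒n∣m x 3) (m%n<n x 3))
  where
  flip : ∀ {k v} → 0 < k → k < 3 → v ≢ 0 → v < 3 → does (3 ∸ v ≟ k) ≡ not (does (v ≟ k))
  flip {_} {0} _ _ v≢0 _ = contradiction refl v≢0
  flip {1} {1} _ _ _ _ = refl
  flip {1} {2} _ _ _ _ = refl
  flip {2} {1} _ _ _ _ = refl
  flip {2} {2} _ _ _ _ = refl
  flip {suc (suc (suc _))} _ (s≤s (s≤s (s≤s ()))) _ _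
  flip {_} {suc (suc (suc _))} _ _ _ (s≤s (s≤s (s≤s ())))

admissible-lower : ∀ {m P s a} j .{{_ : NonZero (3 * m)}} → s * a + a ≡ j * (3 * m) + m → 1 ≤ a → a < m →
                   Admissible m P (s * a % (3 * m))
admissible-lower {m} j eq 1≤a a<m =
  inj₁ (subst (_< m) (sym (residue-% {k = j} (residue-∸ eq (<⇒≤ a<m)) (<-≤-trans m∸a<m (m≤n*m m 3)))) m∸a<m)
  where m∸a<m = ∸-monoʳ-< 1≤a (<⇒≤ a<m)

admissible-middle : ∀ {m P s a} j .{{_ : NonZero (3 * m)}} → s * a + a ≡ j * (3 * m) + 2 * m → a < m →
                    P (2 * m ∸ a) ≡ true → Admissible m P (s * a % (3 * m))
admissible-middle {m} {P} {a = a} j eq a<m P[2m∸a] =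
  inj₂ (subst (λ x → x ≤ 2 * m × P x ≡ true) (sym (residue-% {k = j} (residue-∸ eq a≤2m) 2m∸a<3m))
              (m∸n≤m (2 * m) a , P[2m∸a]))
  where
  a≤2m = ≤-trans (<⇒≤ a<m) (m≤n*m m 2)
  2m∸a<3m = ≤-<-trans (m∸n≤m (2 * m) a) (m<n+m (2 * m) (≤-<-trans z≤n a<m))

module _ (c : ℕ) where

  private
    m = suc (2 * c)

  complementary-isEven : Complementary m isEven
  complementary-isEven x (_ , x<3m , _) _ _ =
    trans (cong (λ u → does (u ≟ 0)) ([n∸x]%2 (3[1+2c]%2≡1 c) (<⇒≤ x<3m))) (flip (m%n<n x 2))
    where
    flip : ∀ {v} → v < 2 → does (1 ∸ v ≟ 0) ≡ not (does (v ≟ 0))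
    flip {0} _ = refl
    flip {1} _ = refl
    flip {suc (suc _)} (s≤s (s≤s ()))

  complementary-aboveHalf : Complementary m (aboveHalf (3 * m))
  complementary-aboveHalf x (_ , x<3m , _) _ _ =
    does-complement (3 * m <? x + x) (3 * m <? y + y)
      (λ 3m<2x 3m<2y → <-asym (y<x 3m<2x) (x<y 3m<2y))
      (λ 3m≮2x → subst (_< y + y) (sym 3m≡y+x)
                   (+-monoʳ-< y (≤∧≢⇒< (≮⇒≥ (3m≮2x ∘ 3m<2x)) x≢y)))
    where
    y = 3 * m ∸ x
    3m≡y+x : 3 * m ≡ y + x
    3m≡y+x = sym (m∸n+n≡m (<⇒≤ x<3m))
    y<x : 3 * m < x + x → y < x
    y<x 3m<2x = +-cancelʳ-< x y x (subst (_< x + x) 3m≡y+x 3m<2x)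
    x<y : 3 * m < y + y → x < y
    x<y 3m<2y = +-cancelˡ-< y x y (subst (_< y + y) 3m≡y+x 3m<2y)
    3m<2x : y < x → 3 * m < x + x
    3m<2x y<x = subst (_< x + x) (sym 3m≡y+x) (+-monoˡ-< x y<x)
    x≢y : x ≢ y
    x≢y x≡y = odd≢x+x x (3[1+2c]%2≡1 c) (trans 3m≡y+x (cong (_+ x) (sym x≡y)))

  admissible-2 : AdmissibleImages m isEven 2
  admissible-2 a _ a<m =
    inj₂ (subst (λ x → x ≤ 2 * m × isEven x ≡ true) (sym (m<n⇒m%n≡m 2a<3m))
                (*-monoʳ-≤ 2 (<⇒≤ a<m) , dec-true (_ ≟ 0) (trans (cong (_% 2) (*-comm 2 a)) (m*n%n≡0 a 2))))
    where 2a<3m = <-≤-trans (*-monoʳ-< 2 a<m) (*-monoˡ-≤ m {2} {3} (s≤s (s≤s z≤n)))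

  admissible-half : AdmissibleImages m (aboveHalf (3 * m)) (3 * c + 2)
  admissible-half a _ a<m with parity-cases a
  ... | b , inj₁ refl = inj₁ (subst (_< m) (sym (residue-% {k = b} (even c b) (<-≤-trans b<m (m≤n*m m 3)))) b<m)
    where
    b<m = ≤-<-trans (m≤m*n b 2) a<m
    even : ∀ c b → (3 * c + 2) * (b * 2) ≡ b * (3 * suc (2 * c)) + b
    even = solve-∀
  ... | b , inj₂ refl = inj₂ (subst (λ x → x ≤ 2 * m × aboveHalf (3 * m) x ≡ true)
                                    (sym (residue-% {k = b} (odd c b) (≤-<-trans x≤2m (m<n+m (2 * m) z<s))))
                                    (x≤2m , dec-true (_ <? _) (<-by (2 * b) (3m<2x c b))))
    where
    x = b + 3 * c + 2
    odd : ∀ c b → (3 * c + 2) * (1 + b * 2) ≡ b * (3 * suc (2 * c)) + (b + 3 * c + 2)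
    odd = solve-∀
    3m<2x : ∀ c b → (b + 3 * c + 2) + (b + 3 * c + 2) ≡ 3 * suc (2 * c) + suc (2 * b)
    3m<2x = solve-∀
    b≤c : b ≤ c
    b≤c = *-cancelˡ-≤ 2 (subst (_≤ 2 * c) (*-comm b 2) (<⇒≤ (s≤s⁻¹ a<m)))
    x≤2m : x ≤ 2 * m
    x≤2m with m≤n⇒∃[o]m+o≡n b≤c
    ... | k , refl = ≤-by k (x≤2m-by b k)
      where
      x≤2m-by : ∀ b k → 2 * suc (2 * (b + k)) ≡ (b + 3 * (b + k) + 2) + k
      x≤2m-by = solve-∀

  module _ (3∣m : 3 ∣ m) where

    [2m∸a]%3 : ∀ {a} → 3 ∤ a → a < m → (2 * m ∸ a) % 3 ≡ 3 ∸ a % 3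
    [2m∸a]%3 3∤a a<m = [n∸x]%3 (∣n⇒∣m*n 2 3∣m) (≤-trans (<⇒≤ a<m) (m≤n*m m 2)) 3∤a

    admissible-m∸1 : AdmissibleImages m (residueIs 1) (2 * c)
    admissible-m∸1 a (_ , _ , 3∤a) a<m with residue₃-cases 3∤a
    ... | j , inj₁ refl = admissible-lower {P = residueIs 1} {2 * c} j (lower c j) z<s a<m
      where
      lower : ∀ c j → 2 * c * (1 + j * 3) + (1 + j * 3) ≡ j * (3 * suc (2 * c)) + suc (2 * c)
      lower = solve-∀
    ... | j , inj₂ refl = admissible-middle {P = residueIs 1} {2 * c} j (middle c j) a<m
                            (dec-true (_ ≟ 1) (trans ([2m∸a]%3 3∤a a<m) (cong (3 ∸_) ([m+kn]%n≡m%n 2 j 3))))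
      where
      middle : ∀ c j → 2 * c * (2 + j * 3) + (2 + j * 3) ≡ j * (3 * suc (2 * c)) + 2 * suc (2 * c)
      middle = solve-∀

    admissible-2m∸1 : AdmissibleImages m (residueIs 2) (4 * c + 1)
    admissible-2m∸1 a (_ , _ , 3∤a) a<m with residue₃-cases 3∤a
    ... | j , inj₁ refl = admissible-middle {P = residueIs 2} {4 * c + 1} (j * 2) (middle c j) a<m
                            (dec-true (_ ≟ 2) (trans ([2m∸a]%3 3∤a a<m) (cong (3 ∸_) ([m+kn]%n≡m%n 1 j 3))))
      where
      middle : ∀ c j → (4 * c + 1) * (1 + j * 3) + (1 + j * 3) ≡ j * 2 * (3 * suc (2 * c)) + 2 * suc (2 * c)
      middle = solve-∀
    ... | j , inj₂ refl = admissible-lower {P = residueIs 2} {4 * c + 1} (j * 2 + 1) (lower c j) z<s a<m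
      where
      lower : ∀ c j → (4 * c + 1) * (2 + j * 3) + (2 + j * 3) ≡ (j * 2 + 1) * (3 * suc (2 * c)) + suc (2 * c)
      lower = solve-∀

candidate-isUnit₃ : ∀ {c s} → 1 ≤ c → 3 ∣ suc (2 * c) → Candidate c s → IsUnit₃ (suc (2 * c)) s × s ≢ 1
candidate-isUnit₃ 1≤c 3∣m (inj₁ refl) = (s≤s z≤n , *-monoʳ-≤ 3 (s≤s z≤n) , from-no (3 ∣? 2)) , λ ()
candidate-isUnit₃ {c} 1≤c 3∣m (inj₂ (inj₁ refl)) =
  (≤-trans (s≤s z≤n) 2≤s , <-by (3 * c) (s<3m c) , subst (3 ∤_) (s≡ c) (3∤-+3* c (from-no (3 ∣? 2)))) , >⇒≢ 2≤s
  where
  2≤s = m≤n+m 2 (3 * c)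
  s<3m : ∀ c → 3 * suc (2 * c) ≡ 3 * c + 2 + suc (3 * c)
  s<3m = solve-∀
  s≡ : ∀ c → 2 + c * 3 ≡ 3 * c + 2
  s≡ = solve-∀
candidate-isUnit₃ {c} 1≤c 3∣m (inj₂ (inj₂ (inj₁ refl))) =
  (≤-trans 1≤c (m≤n*m c 2) , <-≤-trans (n<1+n _) (m≤n*m _ 3) , 3∤∸ 3∣m (s≤s z≤n) (from-no (3 ∣? 1))) ,
  >⇒≢ (*-monoʳ-≤ 2 1≤c)
candidate-isUnit₃ {c} 1≤c 3∣m (inj₂ (inj₂ (inj₂ refl))) =
  (m≤n+m 1 (4 * c) , <-by (2 * c + 1) (s<3m c) , subst (3 ∤_) (s≡ c) 3∤2m∸1) ,
  >⇒≢ (+-monoˡ-< 1 (<-≤-trans z<s (*-monoʳ-≤ 4 1≤c)))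
  where
  s<3m : ∀ c → 3 * suc (2 * c) ≡ 4 * c + 1 + suc (2 * c + 1)
  s<3m = solve-∀
  s≡ : ∀ c → 2 * c + (suc (2 * c) + 0) ≡ 4 * c + 1
  s≡ = solve-∀
  3∤2m∸1 = 3∤∸ (∣n⇒∣m*n 2 3∣m) (s≤s z≤n) (from-no (3 ∣? 1))

candidate⇒inS₃ : ∀ {m c s} .{{_ : NonZero (3 * m)}} → m ≡ suc (2 * c) → 1 ≤ c → 3 ∣ m → Candidate c s → InS₃ m s
candidate⇒inS₃ {c = c} refl 1≤c 3∣m cand with candidate-isUnit₃ 1≤c 3∣m cand
... | u , s≢1 with cand
...   | inj₁ refl =
  inS₃-via isEven u s≢1 (complementary-isEven c) (admissible-2 c)
...   | inj₂ (inj₁ refl) =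
  inS₃-via (aboveHalf (3 * suc (2 * c))) u s≢1 (complementary-aboveHalf c) (admissible-half c)
...   | inj₂ (inj₂ (inj₁ refl)) =
  inS₃-via (residueIs 1) u s≢1 (complementary-residueIs 1 z<s (s≤s (s≤s z≤n))) (admissible-m∸1 c 3∣m)
...   | inj₂ (inj₂ (inj₂ refl)) =
  inS₃-via (residueIs 2) u s≢1 (complementary-residueIs 2 z<s (s≤s (s≤s (s≤s z≤n)))) (admissible-2m∸1 c 3∣m)

upperResidue-direct : ∀ {m y} → 2 * m < y → y < 3 * m → UpperResidue m y
upperResidue-direct {y = y} 2m<y y<3m = 0 , y , refl , 2m<y , y<3m

upperResidue-shift : ∀ {m y} j → UpperResidue m y → UpperResidue m (j * (3 * m) + y)
upperResidue-shift {m} j (k , x , refl , 2m<x , x<3m) = j + k , x , shift , 2m<x , x<3m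
  where
  shift : j * (3 * m) + (k * (3 * m) + x) ≡ (j + k) * (3 * m) + x
  shift = trans (sym (+-assoc (j * (3 * m)) _ x)) (cong (_+ x) (sym (*-distribʳ-+ (3 * m) j k)))

-- y ≡ -z modulo 3m, and -z lies in the upper third when z lies in the middle one.
upperResidue-negate : ∀ {m y z} j → y + z ≡ j * (3 * m) + 4 * m → m < z → z < 2 * m → UpperResidue m y
upperResidue-negate {m} {y} {z} j eq m<z z<2m = j , 4 * m ∸ z , residue-∸ eq z≤4m , 2m<x , x<3m
  where
  double : ∀ m → 4 * m ≡ 2 * m + 2 * m
  double = solve-∀
  2m≤4m : 2 * m ≤ 4 * m
  2m≤4m = subst (2 * m ≤_) (sym (double m)) (m≤m+n (2 * m) (2 * m))
  z≤4m : z ≤ 4 * m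
  z≤4m = ≤-trans (<⇒≤ z<2m) 2m≤4m
  2m<x : 2 * m < 4 * m ∸ z
  2m<x = subst (_< 4 * m ∸ z) (trans (cong (_∸ 2 * m) (double m)) (m+n∸n≡m (2 * m) (2 * m)))
               (∸-monoʳ-< z<2m 2m≤4m)
  x<3m : 4 * m ∸ z < 3 * m
  x<3m = subst (4 * m ∸ z <_) (m+n∸m≡n m (3 * m)) (∸-monoʳ-< m<z z≤4m)

-- 4 + 3j is the least term of 4, 7, 10, … whose multiple by w exceeds n.
progression : ∀ {w n} → 1 ≤ w → w ≤ n → ∃ λ j → n < w * (4 + j * 3) × w * (4 + j * 3) ≤ n + 3 * w
progression {w} {n} 1≤w w≤n = j , n<wb , wb≤n+3w
  where
  instance
    3w≢0 : NonZero (3 * w)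
    3w≢0 = >-nonZero (≤-trans 1≤w (m≤n*m w 3))
  t = n ∸ w
  j = t / (3 * w)
  wb≡ : ∀ w j → w * (4 + j * 3) ≡ w + (3 * w + j * (3 * w))
  wb≡ = solve-∀
  n≡ : n ≡ w + (t % (3 * w) + j * (3 * w))
  n≡ = trans (sym (m+[n∸m]≡n w≤n)) (cong (w +_) (m≡m%n+[m/n]*n t (3 * w)))
  n<wb : n < w * (4 + j * 3)
  n<wb = subst₂ _<_ (sym n≡) (sym (wb≡ w j)) (+-monoʳ-< w (+-monoˡ-< (j * (3 * w)) (m%n<n t (3 * w))))
  wb≤n+3w : w * (4 + j * 3) ≤ n + 3 * w
  wb≤n+3w = begin
    w * (4 + j * 3)                    ≡⟨ wb≡ w j ⟩
    w + (3 * w + j * (3 * w))          ≤⟨ +-monoʳ-≤ w (+-monoʳ-≤ (3 * w) (m≤n+m (j * (3 * w)) (t % (3 * w)))) ⟩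
    w + (3 * w + (t % (3 * w) + j * (3 * w)))   ≡⟨ cong (λ u → w + (3 * w + u)) (m≡m%n+[m/n]*n t (3 * w)) ⟨
    w + (3 * w + t)                    ≡⟨ cong (w +_) (+-comm (3 * w) t) ⟩
    w + (t + 3 * w)                    ≡⟨ +-assoc w t (3 * w) ⟨
    w + t + 3 * w                      ≡⟨ cong (_+ 3 * w) (m+[n∸m]≡n w≤n) ⟩
    n + 3 * w                          ∎
    where open ≤-Reasoning

half<-by : ∀ {v b n m} → v * b ≤ n + 3 * v → 2 * n + 6 * v < v * m → 2 * b < m
half<-by {v} {b} {n} {m} vb≤ bound = *-cancelˡ-< v (2 * b) m (begin-strict
  v * (2 * b)        ≡⟨ twice v b ⟩
  2 * (v * b)        ≤⟨ *-monoʳ-≤ 2 vb≤ ⟩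
  2 * (n + 3 * v)    ≡⟨ *-distribˡ-+ 2 n (3 * v) ⟩
  2 * n + 2 * (3 * v) ≡⟨ cong (2 * n +_) (*-assoc 2 3 v) ⟨
  2 * n + 6 * v      <⟨ bound ⟩
  v * m              ∎)
  where
  open ≤-Reasoning
  twice : ∀ v b → v * (2 * b) ≡ 2 * (v * b)
  twice = solve-∀

4m+6w<wm : ∀ {w m} → 5 ≤ w → 81 ≤ m → 2 * (2 * m) + 6 * w < w * m
4m+6w<wm 5≤w 81≤m =
  subst₂ (λ w m → 2 * (2 * m) + 6 * w < w * m) (proj₂ w′) (proj₂ m′) (bound (proj₁ w′) (proj₁ m′))
  where
  w′ = m≤n⇒∃[o]m+o≡n 5≤w
  m′ = m≤n⇒∃[o]m+o≡n 81≤m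
  expand : ∀ w′ m′ → (5 + w′) * (81 + m′) ≡
                     2 * (2 * (81 + m′)) + 6 * (5 + w′) + suc (50 + 75 * w′ + m′ + w′ * m′)
  expand = solve-∀
  bound : ∀ w′ m′ → 2 * (2 * (81 + m′)) + 6 * (5 + w′) < (5 + w′) * (81 + m′)
  bound w′ m′ = <-by (50 + 75 * w′ + m′ + w′ * m′) (expand w′ m′)

2m+6t<tm : ∀ {t m} → 4 ≤ t → 81 ≤ m → 2 * m + 6 * t < t * m
2m+6t<tm 4≤t 81≤m =
  subst₂ (λ t m → 2 * m + 6 * t < t * m) (proj₂ t′) (proj₂ m′) (bound (proj₁ t′) (proj₁ m′))
  where
  t′ = m≤n⇒∃[o]m+o≡n 4≤t
  m′ = m≤n⇒∃[o]m+o≡n 81≤m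
  expand : ∀ t′ m′ → (4 + t′) * (81 + m′) ≡
                     2 * (81 + m′) + 6 * (4 + t′) + suc (137 + 75 * t′ + 2 * m′ + t′ * m′)
  expand = solve-∀
  bound : ∀ t′ m′ → 2 * (81 + m′) + 6 * (4 + t′) < (4 + t′) * (81 + m′)
  bound t′ m′ = <-by (137 + 75 * t′ + 2 * m′ + t′ * m′) (expand t′ m′)

lower-by-ratio : ∀ {m w} k b → 0 < m → 2 * k < 3 * b → 3 * m ≤ w * k → 2 * m < w * b
lower-by-ratio {m} {w} k b 0<m 2k<3b 3m≤wk = *-cancelˡ-< k (2 * m) (w * b) (begin-strict
  k * (2 * m)    ≡⟨ *-assoc k 2 m ⟨
  k * 2 * m      ≡⟨ cong (_* m) (*-comm k 2) ⟩
  2 * k * m      <⟨ *-monoˡ-< m {{>-nonZero 0<m}} 2k<3b ⟩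
  3 * b * m      ≡⟨ rearrange₁ b m ⟩
  b * (3 * m)    ≤⟨ *-monoʳ-≤ b 3m≤wk ⟩
  b * (w * k)    ≡⟨ rearrange₂ b w k ⟩
  k * (w * b)    ∎)
  where
  open ≤-Reasoning
  rearrange₁ : ∀ b m → 3 * b * m ≡ b * (3 * m)
  rearrange₁ = solve-∀
  rearrange₂ : ∀ b w k → b * (w * k) ≡ k * (w * b)
  rearrange₂ = solve-∀

SmallWitness : ℕ → ℕ → Set
SmallWitness m w = ∃ λ b → SendsLowToHighVia m w b × (5 ≤ w → w + 4 ≤ m → 2 * b < m)

3∤4+3j : ∀ j → 3 ∤ 4 + j * 3
3∤4+3j j = 3∤-+3* (suc j) (from-no (3 ∣? 1))

viaConstant : ∀ {m w} b → 1 ≤ b → 3 ∤ b → 2 * b < m → 2 * m < w * b → w * b < 3 * m → SmallWitness m w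
viaConstant {m} b 1≤b 3∤b 2b<m 2m<wb wb<3m =
  b , (1≤b , 3∤b , ≤-<-trans (m≤n*m b 2) 2b<m , upperResidue-direct {m} 2m<wb wb<3m) , λ _ _ → 2b<m

viaProgression : ∀ {m w} → 81 ≤ m → 4 ≤ w → 3 * w < m → SmallWitness m w
viaProgression {m} {w} 81≤m 4≤w 3w<m = witness (progression {w} {2 * m} (≤-trans (s≤s z≤n) 4≤w) w≤2m)
  where
  w≤2m = ≤-trans (m≤n*m w 3) (≤-trans (<⇒≤ 3w<m) (m≤n*m m 2))
  witness : (∃ λ j → 2 * m < w * (4 + j * 3) × w * (4 + j * 3) ≤ 2 * m + 3 * w) → SmallWitness m w
  witness (j , 2m<wb , wb≤2m+3w) =
    b , (s≤s z≤n , 3∤4+3j j , b<m , upperResidue-direct {m} 2m<wb wb<3m) ,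
    λ 5≤w _ → half<-by {w} {b} {2 * m} wb≤2m+3w (4m+6w<wm 5≤w 81≤m)
    where
    b = 4 + j * 3
    wb<3m : w * b < 3 * m
    wb<3m = ≤-<-trans wb≤2m+3w (subst (2 * m + 3 * w <_) (+-comm (2 * m) m) (+-monoʳ-< (2 * m) 3w<m))
    b<m : b < m
    b<m = *-cancelˡ-< 4 b m (≤-<-trans (*-monoˡ-≤ b 4≤w) (<-≤-trans wb<3m (*-monoˡ-≤ m {3} {4} (n≤1+n 3))))

viaComplement : ∀ {m w t} → w + t ≡ m → 81 ≤ m → 3 * m ≤ w * 4 → 2 ≤ t → SmallWitness m w
viaComplement {w = w} {t} refl 81≤m 3m≤4w 2≤t =
  witness (progression {t} {w + t} (≤-trans (s≤s z≤n) 2≤t) (m≤n+m t w))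
  where
  m = w + t
  three : ∀ w t → 3 * (w + t) ≡ w * 3 + 3 * t
  three = solve-∀
  four : ∀ w → w * 4 ≡ w * 3 + w
  four = solve-∀
  split : ∀ w t j → w * (4 + j * 3) + t * (4 + j * 3) ≡ j * (3 * (w + t)) + 4 * (w + t)
  split = solve-∀
  3t<m : 3 * t < m
  3t<m = ≤-<-trans (+-cancelˡ-≤ (w * 3) (3 * t) w (subst₂ _≤_ (three w t) (four w) 3m≤4w))
                   (m<m+n w (≤-trans (s≤s z≤n) 2≤t))
  witness : (∃ λ j → m < t * (4 + j * 3) × t * (4 + j * 3) ≤ m + 3 * t) → SmallWitness m w
  witness (j , m<tb , tb≤m+3t) =
    b , (s≤s z≤n , 3∤4+3j j , b<m , upperResidue-negate {m} j (split w t j) m<tb tb<2m) ,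
    λ _ w+4≤m → half<-by {t} {b} {m} tb≤m+3t (2m+6t<tm (+-cancelˡ-≤ w 4 t w+4≤m) 81≤m)
    where
    b = 4 + j * 3
    tb<2m : t * b < 2 * m
    tb<2m = ≤-<-trans tb≤m+3t (subst (m + 3 * t <_) (cong (m +_) (sym (+-identityʳ m))) (+-monoʳ-< m 3t<m))
    b<m : b < m
    b<m = *-cancelˡ-< 2 b m (≤-<-trans (*-monoˡ-≤ b 2≤t) tb<2m)

smallWitness : ∀ {m w} → 81 ≤ m → 4 ≤ w → w + 2 ≤ m → SmallWitness m w
smallWitness {m} {w} 81≤m 4≤w w+2≤m with w * 9 <? 3 * m
... | yes 9w<3m = viaProgression 81≤m 4≤w (*-cancelˡ-< 3 (3 * w) m (subst (_< 3 * m) (nine w) 9w<3m))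
  where
  nine : ∀ w → w * 9 ≡ 3 * (3 * w)
  nine = solve-∀
... | no 9w≮3m with w * 7 <? 3 * m
...   | yes 7w<3m = viaConstant {m} {w} 7 (s≤s z≤n) (from-no (3 ∣? 7)) (≤-trans (from-yes (15 ≤? 81)) 81≤m)
                      (lower-by-ratio {m} {w} 9 7 (≤-trans z<s 81≤m) (from-yes (2 * 9 <? 3 * 7)) (≮⇒≥ 9w≮3m)) 7w<3m
...   | no 7w≮3m with w * 5 <? 3 * m
...     | yes 5w<3m = viaConstant {m} {w} 5 (s≤s z≤n) (from-no (3 ∣? 5)) (≤-trans (from-yes (11 ≤? 81)) 81≤m)
                        (lower-by-ratio {m} {w} 7 5 (≤-trans z<s 81≤m) (from-yes (2 * 7 <? 3 * 5)) (≮⇒≥ 7w≮3m)) 5w<3m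
...     | no 5w≮3m with w * 4 <? 3 * m
...       | yes 4w<3m = viaConstant {m} {w} 4 (s≤s z≤n) (from-no (3 ∣? 4)) (≤-trans (from-yes (9 ≤? 81)) 81≤m)
                          (lower-by-ratio {m} {w} 5 4 (≤-trans z<s 81≤m) (from-yes (2 * 5 <? 3 * 4)) (≮⇒≥ 5w≮3m)) 4w<3m
...       | no 4w≮3m = viaComplement (m+[n∸m]≡n w≤m) 81≤m (≮⇒≥ 4w≮3m)
                         (+-cancelˡ-≤ w 2 (m ∸ w) (subst (w + 2 ≤_) (sym (m+[n∸m]≡n w≤m)) w+2≤m))
  where w≤m = ≤-trans (m≤m+n w 2) w+2≤m
4≤unit : ∀ {s} → 1 ≤ s → s ≢ 1 → s ≢ 2 → 3 ∤ s → 4 ≤ s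
4≤unit {1} _ s≢1 _ _ = contradiction refl s≢1
4≤unit {2} _ _ s≢2 _ = contradiction refl s≢2
4≤unit {3} _ _ _ 3∤s = contradiction ∣-refl 3∤s
4≤unit {suc (suc (suc (suc _)))} _ _ _ _ = s≤s (s≤s (s≤s (s≤s z≤n)))

module _ {c : ℕ} (81≤m : 81 ≤ suc (2 * c)) where

  private
    m = suc (2 * c)

  classify-lower : ∀ {s} → 1 ≤ s → 3 ∤ s → s ≢ 1 → s < m → Candidate c s ⊎ SendsLowToHigh m s
  classify-lower {s} 1≤s 3∤s s≢1 s<m with s ≟ 2 | suc s ≟ m
  ... | yes s≡2 | _         = inj₁ (inj₁ s≡2)
  ... | no _    | yes 1+s≡m = inj₁ (inj₂ (inj₂ (inj₁ (suc-injective 1+s≡m))))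
  ... | no s≢2  | no 1+s≢m  with smallWitness 81≤m (4≤unit 1≤s s≢1 s≢2 3∤s)
                                   (subst (_≤ m) (+-comm 2 s) (≤∧≢⇒< s<m 1+s≢m))
  ...   | b , via , _ = inj₂ (b , via)

  sendsLowToHigh-upper : ∀ {s} e → suc (3 * c + 2) + suc e ≡ s → s < 2 * m → s ≢ 4 * c + 1 → SendsLowToHigh m s
  sendsLowToHigh-upper {s} e refl s<2m s≢4c+1 = doubled (smallWitness 81≤m 4≤w w+2≤m)
    where
    2m≡ : ∀ c → 2 * suc (2 * c) ≡ suc (suc (4 * c))
    2m≡ = solve-∀
    s≡ : ∀ c e → suc (3 * c + 2) + suc e ≡ 3 * c + (e + 4)
    s≡ = solve-∀
    4c≡ : ∀ c → 4 * c ≡ 3 * c + c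
    4c≡ = solve-∀
    w+4≡ : ∀ e → suc (2 * (e + 4)) ≡ 2 * e + 5 + 4
    w+4≡ = solve-∀
    2s≡ : ∀ c e b → (suc (3 * c + 2) + suc e) * (2 * b) ≡ b * (3 * suc (2 * c)) + (2 * e + 5) * b
    2s≡ = solve-∀
    s≤4c : s ≤ 4 * c
    s≤4c = s≤s⁻¹ (≤∧≢⇒< (s≤s⁻¹ (subst (s <_) (2m≡ c) s<2m)) (λ eq → s≢4c+1 (trans eq (+-comm 1 (4 * c)))))
    e+4≤c : e + 4 ≤ c
    e+4≤c = +-cancelˡ-≤ (3 * c) (e + 4) c (subst₂ _≤_ (s≡ c e) (4c≡ c) s≤4c)
    w = 2 * e + 5
    5≤w : 5 ≤ w
    5≤w = m≤n+m 5 (2 * e)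
    4≤w : 4 ≤ w
    4≤w = ≤-trans (n≤1+n 4) 5≤w
    w+4≤m : w + 4 ≤ m
    w+4≤m = subst (_≤ m) (w+4≡ e) (s≤s (*-monoʳ-≤ 2 e+4≤c))
    w+2≤m : w + 2 ≤ m
    w+2≤m = ≤-trans (+-monoʳ-≤ w (s≤s (s≤s z≤n))) w+4≤m
    doubled : SmallWitness m w → SendsLowToHigh m s
    doubled (b , (1≤b , 3∤b , _ , ur) , half) =
      2 * b , ≤-trans 1≤b (m≤n*m b 2) , 3∤* (from-no (3 ∣? 2)) 3∤b , half 5≤w w+4≤m ,
      subst (UpperResidue m) (sym (2s≡ c e b)) (upperResidue-shift {m} b ur)

  classify-upper : ∀ {s} → 3 ∤ s → s < 2 * m → 3 * m ≤ s * 2 → Candidate c s ⊎ SendsLowToHigh m s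
  classify-upper {s} 3∤s s<2m 3m≤2s with s ≟ 3 * c + 2 | s ≟ 4 * c + 1
  ... | yes s≡ | _      = inj₁ (inj₂ (inj₁ s≡))
  ... | no _   | yes s≡ = inj₁ (inj₂ (inj₂ (inj₂ s≡)))
  ... | no s≢  | no s≢′ with m≤n⇒∃[o]m+o≡n (≤∧≢⇒< 3c+2≤s (λ eq → s≢ (sym eq)))
    where
    3m≡ : ∀ c → 3 * suc (2 * c) ≡ (3 * c + 1) * 2 + suc 0
    3m≡ = solve-∀
    3c+2≤s : 3 * c + 2 ≤ s
    3c+2≤s = ≮⇒≥ λ s<3c+2 → <⇒≱ (<-by 0 (3m≡ c))
      (≤-trans 3m≤2s (*-monoˡ-≤ 2 (s≤s⁻¹ (subst (s <_) (+-suc (3 * c) 1) s<3c+2))))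
  ...   | 0 , eq     = contradiction (subst (3 ∣_) eq (divides (c + 1) (3[c+1]≡ c))) 3∤s
    where
    3[c+1]≡ : ∀ c → suc (3 * c + 2) + 0 ≡ (c + 1) * 3
    3[c+1]≡ = solve-∀
  ...   | suc e , eq = inj₂ (sendsLowToHigh-upper e eq s<2m s≢′)

  classify-large : 3 ∣ m → ∀ {s} → IsUnit₃ m s → s ≢ 1 → Candidate c s ⊎ SendsLowToHigh m s
  classify-large 3∣m {s} (1≤s , s<3m , 3∤s) s≢1 with <-cmp s m
  ... | tri< s<m _ _  = classify-lower 1≤s 3∤s s≢1 s<m
  ... | tri≈ _ refl _ = contradiction 3∣m 3∤s
  ... | tri> _ _ m<s with <-cmp s (2 * m)
  ...   | tri≈ _ refl _ = contradiction (∣n⇒∣m*n 2 3∣m) 3∤s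
  ...   | tri> _ _ 2m<s =
    inj₂ (1 , s≤s z≤n , from-no (3 ∣? 1) , ≤-trans (s≤s (s≤s z≤n)) 81≤m ,
          subst (UpperResidue m) (sym (*-identityʳ s)) (upperResidue-direct {m} 2m<s s<3m))
  ...   | tri< s<2m _ _ with s * 2 <? 3 * m
  ...     | yes 2s<3m =
    inj₂ (2 , s≤s z≤n , from-no (3 ∣? 2) , ≤-trans (s≤s (s≤s (s≤s z≤n))) 81≤m ,
          upperResidue-direct {m} (subst (_< s * 2) (*-comm m 2) (*-monoˡ-< 2 m<s)) 2s<3m)
  ...     | no 2s≮3m = classify-upper 3∤s s<2m (≮⇒≥ 2s≮3m)

-- The moduli 9, 27 and 81, too small for the estimates above, are classified exhaustively

module _ (m : ℕ) .{{_ : NonZero (3 * m)}} where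

  SendsLowToHigh% : ℕ → Set
  SendsLowToHigh% s = ∃ λ (a : Fin m) → 1 ≤ toℕ a × 3 ∤ toℕ a × 2 * m < s * toℕ a % (3 * m)

  sendsLowToHigh%? : ∀ s → Dec (SendsLowToHigh% s)
  sendsLowToHigh%? s = any? λ a → 1 ≤? toℕ a ×-dec ¬? (3 ∣? toℕ a) ×-dec 2 * m <? s * toℕ a % (3 * m)

  sendsLowToHigh%⇒sendsLowToHigh : ∀ {s} → SendsLowToHigh% s → SendsLowToHigh m s
  sendsLowToHigh%⇒sendsLowToHigh {s} (a , 1≤a , 3∤a , 2m<x) =
    toℕ a , 1≤a , 3∤a , toℕ<n a , s * toℕ a / (3 * m) , s * toℕ a % (3 * m) ,
    trans (m≡m%n+[m/n]*n (s * toℕ a) (3 * m)) (+-comm (s * toℕ a % (3 * m)) _) , 2m<x , m%n<n _ (3 * m)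

  Classified : ℕ → ℕ → Set
  Classified c s = 3 ∣ s ⊎ s ≡ 0 ⊎ s ≡ 1 ⊎ Candidate c s ⊎ SendsLowToHigh% s

  classified? : ∀ c s → Dec (Classified c s)
  classified? c s = 3 ∣? s ⊎-dec s ≟ 0 ⊎-dec s ≟ 1 ⊎-dec
                    (s ≟ 2 ⊎-dec s ≟ 3 * c + 2 ⊎-dec s ≟ 2 * c ⊎-dec s ≟ 4 * c + 1) ⊎-dec sendsLowToHigh%? s

  classify-by-computation : ∀ c → (∀ (i : Fin (3 * m)) → Classified c (toℕ i)) →
                            ∀ {s} → IsUnit₃ m s → s ≢ 1 → Candidate c s ⊎ SendsLowToHigh m s
  classify-by-computation c classified {s} (1≤s , s<3m , 3∤s) s≢1
    with subst (Classified c) (toℕ-fromℕ< s<3m) (classified (fromℕ< s<3m))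
  ... | inj₁ 3∣s                          = contradiction 3∣s 3∤s
  ... | inj₂ (inj₁ refl)                  = contradiction 1≤s λ ()
  ... | inj₂ (inj₂ (inj₁ s≡1))            = contradiction s≡1 s≢1
  ... | inj₂ (inj₂ (inj₂ (inj₁ cand)))    = inj₁ cand
  ... | inj₂ (inj₂ (inj₂ (inj₂ sends)))   = inj₂ (sendsLowToHigh%⇒sendsLowToHigh {s} sends)

classified-9 : ∀ (i : Fin 9) → Classified 3 1 (toℕ i)
classified-9 = from-yes (all? {n = 9} λ i → classified? 3 1 (toℕ i))

classified-27 : ∀ (i : Fin 27) → Classified 9 4 (toℕ i)
classified-27 = from-yes (all? {n = 27} λ i → classified? 9 4 (toℕ i))

classified-81 : ∀ (i : Fin 81) → Classified 27 13 (toℕ i)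
classified-81 = from-yes (all? {n = 81} λ i → classified? 27 13 (toℕ i))

3^≡odd : ∀ n → ∃ λ c → 3 ^ n ≡ suc (2 * c)
3^≡odd zero = 0 , refl
3^≡odd (suc n) = 3 * c + 1 , trans (cong (3 *_) 3^n≡) (triple c)
  where
  c = proj₁ (3^≡odd n)
  3^n≡ = proj₂ (3^≡odd n)
  triple : ∀ c → 3 * suc (2 * c) ≡ suc (2 * (3 * c + 1))
  triple = solve-∀

1+2*-injective : ∀ d c → suc (2 * d) ≡ suc (2 * c) → d ≡ c
1+2*-injective d c eq = *-cancelˡ-≡ d c 2 (suc-injective eq)

classify-3^ : ∀ n {c s} → 3 ^ suc n ≡ suc (2 * c) → IsUnit₃ (3 ^ suc n) s → s ≢ 1 →
              Candidate c s ⊎ SendsLowToHigh (3 ^ suc n) s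
classify-3^ 0 {c} {s} m≡ u s≢1 =
  subst (λ c → Candidate c s ⊎ SendsLowToHigh 3 s) (1+2*-injective 1 c m≡)
        (classify-by-computation 3 1 classified-9 u s≢1)
classify-3^ 1 {c} {s} m≡ u s≢1 =
  subst (λ c → Candidate c s ⊎ SendsLowToHigh 9 s) (1+2*-injective 4 c m≡)
        (classify-by-computation 9 4 classified-27 u s≢1)
classify-3^ 2 {c} {s} m≡ u s≢1 =
  subst (λ c → Candidate c s ⊎ SendsLowToHigh 27 s) (1+2*-injective 13 c m≡)
        (classify-by-computation 27 13 classified-81 u s≢1)
classify-3^ (suc (suc (suc n))) {c} {s} m≡ u s≢1 =
  subst (λ m → Candidate c s ⊎ SendsLowToHigh m s) (sym m≡)
        (classify-large {c} (subst (81 ≤_) m≡ 81≤m) (subst (3 ∣_) m≡ (3∣3* (3 ^ suc (suc (suc n)))))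
                        (subst (λ m → IsUnit₃ m s) m≡ u) s≢1)
  where 81≤m = ^-monoʳ-≤ 3 {4} {4 + n} (m≤m+n 4 n)

inS⇔candidate : ∀ n c .{{_ : NonZero (3 ^ suc (suc n))}} → 3 ^ suc n ≡ suc (2 * c) →
                ∀ s → InS (3 ^ suc (suc n)) s ⇔ Candidate c s
inS⇔candidate n c m≡ s = mk⇔
  (λ s∈S → let (u , s≢1 , _) = to s∈S in
           [ id , (λ sends → contradiction sends (inS₃⇒¬sendsLowToHigh (to s∈S))) ]′ (classify-3^ n {c} m≡ u s≢1))
  (λ cand → from (candidate⇒inS₃ {3 ^ suc n} {c} m≡ 1≤c (3∣3* (3 ^ n)) cand))
  where
  open Equivalence (inS⇔inS₃ (suc n) s)
  1≤c : 1 ≤ c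
  1≤c = n≢0⇒n>0 λ c≡0 → <⇒≱ (s≤s (s≤s z≤n))
    (subst (3 ≤_) (trans m≡ (cong (λ c → suc (2 * c)) c≡0)) (*-monoʳ-≤ 3 (m^n>0 3 n)))

candidate-values : ∀ m c → m ≡ suc (2 * c) →
  (3 * m + 1) / 2 ≡ 3 * c + 2 × (3 * m) / 3 ∸ 1 ≡ 2 * c × (2 * (3 * m)) / 3 ∸ 1 ≡ 4 * c + 1
candidate-values _ c refl =
  trans (cong (_/ 2) (half c)) (m*n/n≡m (3 * c + 2) 2) ,
  cong (_∸ 1) (trans (cong (_/ 3) (*-comm 3 (suc (2 * c)))) (m*n/n≡m (suc (2 * c)) 3)) ,
  trans (cong (_∸ 1) (trans (cong (_/ 3) (twoThirds c)) (m*n/n≡m (2 * suc (2 * c)) 3))) (2m∸1 c)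
  where
  half : ∀ c → 3 * suc (2 * c) + 1 ≡ (3 * c + 2) * 2
  half = solve-∀
  twoThirds : ∀ c → 2 * (3 * suc (2 * c)) ≡ 2 * suc (2 * c) * 3
  twoThirds = solve-∀
  2m∸1 : ∀ c → 2 * c + (suc (2 * c) + 0) ≡ 4 * c + 1
  2m∸1 = solve-∀

lemma5p14 : (r : ℕ) → (q : ℕ) → .{{_ : NonZero q}} → q ≡ 3 ^ r → 9 ≤ q →
    (s : ℕ) →
    InS q s ⇔ (s ≡ 2 ⊎ s ≡ (q + 1) / 2 ⊎ s ≡ q / 3 ∸ 1 ⊎ s ≡ (2 * q) / 3 ∸ 1)
lemma5p14 0 _ refl (s≤s ())
lemma5p14 1 _ refl (s≤s (s≤s (s≤s ())))
lemma5p14 (suc (suc n)) _ refl _ s with 3^≡odd (suc n)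
... | c , m≡ rewrite proj₁ (candidate-values (3 ^ suc n) c m≡)
                   | proj₁ (proj₂ (candidate-values (3 ^ suc n) c m≡))
                   | proj₂ (proj₂ (candidate-values (3 ^ suc n) c m≡)) = inS⇔candidate n c m≡ s
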